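{- Let $T$ be a strong monad and $R$ a $T$-algebra. Let $\varepsilon \colon (X \to R) \to TX$ and $\delta \colon X \to ((Y \to R) \to TY)$ (write $\delta_x = \delta(x)$). Then \[ \overline{\varepsilon \otimes^{J} \delta} = \overline{\varepsilon} \otimes^{K} (\lambda x . \overline{\delta_x}), \] i.e. for every $q \colon X \times Y \to R$, $\overline{\varepsilon \otimes^{J} \delta}(q) = \overline{\varepsilon}\big(\lambda x . \overline{\delta_x}(q_x)\big)$.
   Context: Work in Gödel's System T with full extensionality. A strong monad $T$ has families of closed terms $\eta_X \colon X \to TX$ and $(\cdot)^\dagger \colon (X \to TY) \to (TX \to TY)$ with $(\eta_X)^\dagger = \mathrm{id}$, $g^\dagger \circ \eta = g$, $(g^\dagger \circ f)^\dagger = g^\dagger \circ f^\dagger$. A $T$-algebra $R$ has maps $(\cdot)^* \colon (X \to R) \to (TX \to R)$ with $g^* \circ \eta = g$ and $(g^* \circ f)^* = g^* \circ f^\dagger$. The product of $T$ is $a \otimes^T f = (\lambda x . (\lambda y . \eta_{X\times Y}(x,y))^\dagger(f x))^\dagger(a) \colon T(X \times Y)$ for $a \colon TX$, $f \colon X \to TY$. For $q \colon X \times Y \to R$ write $q_x = \lambda y . q(x,y)$. The product of $T$-selection functions is defined by $(\varepsilon \otimes^{J} \delta)(q) = a \otimes^T f$, where $f(x) = \delta_x(q_x) \colon TY$ and $a = \varepsilon(\lambda x . (q_x)^*(f x)) \colon TX$. Let $K_R X = (X \to R) \to R$ (quantifiers) with product $(\phi \otimes^K \psi)(q) = \phi(\lambda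 x . \psi_x(q_x))$ for $\phi \colon K_R X$, $\psi \colon X \to K_R Y$, $q \colon X \times Y \to R$. For a $T$-selection function $\varepsilon \colon (X \to R) \to TX$, the quantifier $\overline{\varepsilon} \colon K_R X$ is $\overline{\varepsilon}(p) = p^*(\varepsilon p)$. -}

module Defs where

open import Level using (Level; suc; _⊔_)
open import Data.Product using (_×_; _,_)
open import Function using (_∘_; id)
open import Relation.Binary.PropositionalEquality using (_≡_)

-- A (strong) monad on the types of System T, modelled as Agda types.
-- Strength is automatic since Kleisli extension is a (higher-order) term.
record Monad : Set₁ where
  field
    T    : Set → Set
    η    : {X : Set} → X → T X
    ext  : {X Y : Set} → (X → T Y) → (T X → T Y)
    unit-ext : {X : Set} → ext (η {X}) ≡ id
    ext-unit : {X Y : Set} (g : X → T Y) → ext g ∘ η ≡ g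
    ext-assoc : {X Y Z : Set} (f : X → T Y) (g : Y → T Z) →
                ext (ext g ∘ f) ≡ ext g ∘ ext f

record Algebra (M : Monad) (R : Set) : Set₁ where
  open Monad M
  field
    alg : {X : Set} → (X → R) → (T X → R)
    alg-unit : {X : Set} (g : X → R) → alg g ∘ η ≡ g
    alg-assoc : {X Y : Set} (f : X → T Y) (g : Y → R) →
                alg (alg g ∘ f) ≡ alg g ∘ ext f

module _ (M : Monad) where
  open Monad M

  _⊗T_ : {X Y : Set} → T X → (X → T Y) → T (X × Y)
  a ⊗T f = ext (λ x → ext (λ y → η (x , y)) (f x)) a

  JT : Set → Set → Set
  JT R X = (X → R) → T X

  K : Set → Set → Set
  K R X = (X → R) → R

  _⊗K_ : {R X Y : Set} → K R X → (X → K R Y) → K R (X × Y)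
  (φ ⊗K ψ) q = φ (λ x → ψ x (λ y → q (x , y)))

  module _ {R : Set} (A : Algebra M R) where
    open Algebra A

    _⊗J_ : {X Y : Set} → JT R X → (X → JT R Y) → JT R (X × Y)
    (ε ⊗J δ) q = a ⊗T f
      where
        f = λ x → δ x (λ y → q (x , y))
        a = ε (λ x → alg (λ y → q (x , y)) (f x))

    bar : {X : Set} → JT R X → K R X
    bar ε p = alg p (ε p)

module Submission where

-- Unfolding the definitions, with f x = δ x q_x and p x = (q_x)* (f x),
-- the left-hand side is q* (ε p ⊗^T f) and the right-hand side is
-- p* (ε p).  So the theorem is an instance of a fact about the monad
-- product alone:  for every T-algebra R,
--      q* (a ⊗^T f) = (λ x → (q_x)* (f x))* a .
-- This is proved in two steps from the algebra laws (plus function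
-- extensionality): first, an algebra map absorbs a Kleisli extension,
-- g* (f† a) = (g* ∘ f)* a; second, as a consequence, it absorbs the
-- functorial action of T, q* (T k b) = (q ∘ k)* b.  The product a ⊗^T f
-- is a Kleisli extension of such functorial actions, whence the fact.

open import Defs
open import Data.Product using (_×_; _,_)
open import Function using (_∘_)
open import Relation.Binary.PropositionalEquality
  using (_≡_; cong; cong-app; sym; module ≡-Reasoning)
open import Level using (0ℓ)
open import Axiom.Extensionality.Propositional using (Extensionality)

module AlgebraProperties (fe : Extensionality 0ℓ 0ℓ)
                         (M : Monad) {R : Set} (A : Algebra M R) where
  open Monad M
  open Algebra A
  open ≡-Reasoning

  fmap : {Y Z : Set} → (Y → Z) → T Y → T Z
  fmap k = ext (η ∘ k)

  alg-ext : {X Y : Set} (f : X → T Y) (g : Y → R) (a : T X) →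
            alg g (ext f a) ≡ alg (alg g ∘ f) a
  alg-ext f g a = sym (cong-app (alg-assoc f g) a)

  alg-fmap : {Y Z : Set} (k : Y → Z) (q : Z → R) (b : T Y) →
             alg q (fmap k b) ≡ alg (q ∘ k) b
  alg-fmap k q b = begin
    alg q (ext (η ∘ k) b)      ≡⟨ alg-ext (η ∘ k) q b ⟩
    alg (alg q ∘ η ∘ k) b      ≡⟨ cong (λ g → alg (g ∘ k) b) (alg-unit q) ⟩
    alg (q ∘ k) b              ∎

  alg-⊗T : {X Y : Set} (a : T X) (f : X → T Y) (q : X × Y → R) →
           alg q (_⊗T_ M a f) ≡ alg (λ x → alg (λ y → q (x , y)) (f x)) a
  alg-⊗T a f q = begin
    alg q (ext (λ x → fmap (x ,_) (f x)) a)
      ≡⟨ alg-ext (λ x → fmap (x ,_) (f x)) q a ⟩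
    alg (λ x → alg q (fmap (x ,_) (f x))) a
      ≡⟨ cong (λ g → alg g a) (fe (λ x → alg-fmap (x ,_) q (f x))) ⟩
    alg (λ x → alg (λ y → q (x , y)) (f x)) a
      ∎

lemma2p4 : Extensionality 0ℓ 0ℓ →
    (M : Monad) {R : Set} (A : Algebra M R) {X Y : Set}
    (ε : JT M R X) (δ : X → JT M R Y) (q : X × Y → R) →
    bar M A (_⊗J_ M A ε δ) q ≡ _⊗K_ M (bar M A ε) (λ x → bar M A (δ x)) q
lemma2p4 fe M {R} A {X} {Y} ε δ q = alg-⊗T (ε p) f q
  where
    open Monad M using (T)
    open Algebra A using (alg)
    open AlgebraProperties fe M A using (alg-⊗T)
    f : X → T Y
    f x = δ x (λ y → q (x , y))
    p : X → R
    p x = alg (λ y → q (x , y)) (f x)
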